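{- Let $a,b,r,n$ be integers with $0\le a\le b$, $0\le r\le n$, $a\le r$ and $b-a\le n-r$. If $M$ is a matroid of rank $r$ on an $n$-element ground set that does not have the uniform matroid $U_{a,b}$ as a minor, then $d(M)\ge 1/\binom{b}{a}$.
   Context: For a matroid $M$ of rank $r$ on $n$ elements, $d(M)$ is the number of dependent $r$-element subsets of the ground set divided by $\binom{n}{r}$. $U_{a,b}$ is the uniform matroid of rank $a$ on $b$ elements. -}

module Defs where

open import Data.Bool using (Bool; true; false; not; _∧_)
open import Data.Nat using (ℕ; zero; suc; _+_; _≤_; _<_; _≡ᵇ_)
open import Data.Fin using (Fin)
open import Data.Fin.Subset using (Subset; ⊥; ⁅_⁆; _∈_; _∉_; _⊆_; _∪_; _∩_; ∣_∣; inside; outside)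
open import Data.List using (List; []; _∷_; map; _++_)
open import Data.Vec using (_∷_; [])
open import Data.Product using (Σ; ∃; ∃-syntax; _×_; _,_)
open import Relation.Binary.PropositionalEquality using (_≡_)
open import Relation.Nullary using (¬_)

record Matroid (n : ℕ) : Set where
  field
    indep     : Subset n → Bool
    indep-∅   : indep ⊥ ≡ true
    indep-⊆   : ∀ {X Y} → Y ⊆ X → indep X ≡ true → indep Y ≡ true
    indep-aug : ∀ {X Y} → indep X ≡ true → indep Y ≡ true → ∣ X ∣ < ∣ Y ∣ →
                ∃[ e ] (e ∈ Y × e ∉ X × indep (⁅ e ⁆ ∪ X) ≡ true)
open Matroid public

HasRank : ∀ {n} → Matroid n → ℕ → Set
HasRank {n} M r =
  (∃[ X ] (indep M X ≡ true × ∣ X ∣ ≡ r)) ×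
  (∀ (X : Subset n) → indep M X ≡ true → ∣ X ∣ ≤ r)

allSubsets : ∀ n → List (Subset n)
allSubsets zero    = [] ∷ []
allSubsets (suc n) = map (inside ∷_) (allSubsets n) ++ map (outside ∷_) (allSubsets n)

count : ∀ {A : Set} → (A → Bool) → List A → ℕ
count p []       = 0
count p (x ∷ xs) with p x
... | true  = suc (count p xs)
... | false = count p xs

numDependent : ∀ {n} → Matroid n → ℕ → ℕ
numDependent {n} M r = count (λ X → (∣ X ∣ ≡ᵇ r) ∧ not (indep M X)) (allSubsets n)

IsBasisOf : ∀ {n} → Matroid n → Subset n → Subset n → Set
IsBasisOf M C B =
  B ⊆ C × indep M B ≡ true ×
  (∀ e → e ∈ C → e ∉ B → indep M (⁅ e ⁆ ∪ B) ≡ false)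

-- Independence in the contraction M/C of a set I ⊆ E - C:
-- I ∪ B is independent in M for a basis B of M|C.
ContractIndep : ∀ {n} → Matroid n → Subset n → Subset n → Set
ContractIndep M C I = ∃[ B ] (IsBasisOf M C B × indep M (I ∪ B) ≡ true)

Disjoint : ∀ {n} → Subset n → Subset n → Set
Disjoint X Y = ∀ e → e ∈ X → e ∉ Y

-- M has a U_{a,b} minor: there are disjoint C (contracted) and Y (kept;
-- everything else deleted) with |Y| = b such that the minor M/C|Y is the
-- uniform matroid of rank a on Y, i.e. its independent sets are exactly the
-- subsets of Y of size ≤ a (so M/C|Y ≅ U_{a,b} via any bijection Y ≃ Fin b).
HasUniformMinor : ∀ {n} → Matroid n → ℕ → ℕ → Set
HasUniformMinor {n} M a b =
  ∃[ C ] ∃[ Y ] (Disjoint C Y × ∣ Y ∣ ≡ b ×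
    (∀ (X : Subset n) → X ⊆ Y → (ContractIndep M C X → ∣ X ∣ ≤ a) × (∣ X ∣ ≤ a → ContractIndep M C X)))

-- Double counting.  Count the disjoint triples (Z, A, W) with |Z| = r - a,
-- |A| = a, |W| = b - a, once with weight 1 and once with weight [Z ∪ A is
-- dependent].  Grouped by the r-set Z ∪ A, each r-set is hit
-- K = C(r, a) C(n - r, b - a) times.  Grouped by the pair (Z, Y = A ∪ W),
-- each pair is hit at most C(b, a) times, and at least once with a
-- dependent Z ∪ A: otherwise M / Z | Y would be U_{a,b}.  Hence
-- K C(n, r) ≤ C(b, a) K d, where d is the number of dependent r-sets.
module Submission where

open import Data.Bool using (Bool; true; false; not; _∧_; T)
open import Data.Bool.Properties using (∧-identityʳ; not-injective)
open import Data.Fin using () renaming (zero to fzero; suc to fsuc)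
open import Data.Fin.Subset using (Subset; ∣_∣; ∁; _⊆_; _∪_)
open import Data.Fin.Subset.Properties
  using ( drop-∷-⊆; out⊆; in⊆in; ⊆-refl; ⊆-min; p⊆q⇒∣p∣≤∣q∣; ∣⊥∣≡0; ∣∁p∣≡n∸∣p∣
        ; p⊆p∪q; q⊆p∪q; x∈p∪q⁻)
open import Data.List using ([]; _∷_; map; _++_)
open import Data.Nat using (ℕ; zero; suc; _+_; _*_; _∸_; _≤_; _<_; _≡ᵇ_; z≤n; s≤s; >-nonZero)
open import Data.Nat.Combinatorics using (_C_; nCk+nC[k+1]≡[n+1]C[k+1])
open import Data.Nat.Properties
open import Algebra.Properties.CommutativeSemigroup +-commutativeSemigroup
  using () renaming (interchange to +-interchange)
open import Data.Nat.Tactic.RingSolver using (solve-∀)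
open import Data.Product using (∃-syntax; _×_; _,_)
open import Data.Sum using (_⊎_; inj₁; inj₂)
open import Data.Vec using (Vec; []; _∷_; here; there)
open import Relation.Binary.PropositionalEquality
open import Relation.Nullary using (¬_; contradiction; yes; no)

open import Defs

indicator : Bool → ℕ
indicator true  = 1
indicator false = 0

indicator≤1 : ∀ b → indicator b ≤ 1
indicator≤1 true  = ≤-refl
indicator≤1 false = z≤n

count-++ : ∀ {A : Set} (p : A → Bool) xs ys → count p (xs ++ ys) ≡ count p xs + count p ys
count-++ p []       ys = refl
count-++ p (x ∷ xs) ys with p x
... | true  = cong suc (count-++ p xs ys)
... | false = count-++ p xs ys

count-map : ∀ {A B : Set} (p : B → Bool) (g : A → B) xs →
            count p (map g xs) ≡ count (λ x → p (g x)) xs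
count-map p g []       = refl
count-map p g (x ∷ xs) with p (g x)
... | true  = cong suc (count-map p g xs)
... | false = count-map p g xs

-- The counting sums below carry, for each counted colour, the number of its
-- occurrences still to be placed: atSuc places one, atZero checks that none
-- remain.
atZero : ℕ → ℕ → ℕ
atZero zero    v = v
atZero (suc _) _ = 0

atSuc : ℕ → (ℕ → ℕ) → ℕ
atSuc zero    g = 0
atSuc (suc k) g = g k

atSuc-cong : ∀ k {g h : ℕ → ℕ} → (∀ j → g j ≡ h j) → atSuc k g ≡ atSuc k h
atSuc-cong zero    _  = refl
atSuc-cong (suc k) eq = eq k

atSuc-0 : ∀ k → atSuc k (λ _ → 0) ≡ 0
atSuc-0 zero    = refl
atSuc-0 (suc k) = refl

atSuc-+ : ∀ k (g h : ℕ → ℕ) → atSuc k (λ j → g j + h j) ≡ atSuc k g + atSuc k h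
atSuc-+ zero    g h = refl
atSuc-+ (suc k) g h = refl

atSuc-*ˡ : ∀ k m (g : ℕ → ℕ) → atSuc k (λ j → m * g j) ≡ m * atSuc k g
atSuc-*ˡ zero    m g = sym (*-zeroʳ m)
atSuc-*ˡ (suc k) m g = refl

atSuc-*ʳ : ∀ k m (g : ℕ → ℕ) → atSuc k (λ j → g j * m) ≡ atSuc k g * m
atSuc-*ʳ zero    m g = refl
atSuc-*ʳ (suc k) m g = refl

atSuc-mono-≤ : ∀ k {g h : ℕ → ℕ} → (∀ j → g j ≤ h j) → atSuc k g ≤ atSuc k h
atSuc-mono-≤ zero    _  = z≤n
atSuc-mono-≤ (suc k) le = le k

atZero-* : ∀ k v → atZero k v ≡ v * atZero k 1
atZero-* zero    v = sym (*-identityʳ v)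
atZero-* (suc k) v = sym (*-zeroʳ v)

choose : ℕ → ℕ → ℕ
choose m       zero    = 1
choose zero    (suc k) = 0
choose (suc m) (suc k) = choose m k + choose m (suc k)

choose≡C : ∀ m k → choose m k ≡ m C k
choose≡C m       zero    = refl
choose≡C zero    (suc k) = refl
choose≡C (suc m) (suc k) =
  trans (cong₂ _+_ (choose≡C m k) (choose≡C m (suc k))) (nCk+nC[k+1]≡[n+1]C[k+1] m k)

choose-suc : ∀ m k → choose m k + atSuc k (choose m) ≡ choose (suc m) k
choose-suc m zero    = refl
choose-suc m (suc k) = +-comm (choose m (suc k)) (choose m k)

choose-pos : ∀ {m k} → k ≤ m → 0 < choose m k
choose-pos {m}     {zero}  _         = s≤s z≤n
choose-pos {suc m} {suc k} (s≤s k≤m) = ≤-trans (choose-pos k≤m) (m≤m+n _ _)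

sumSubsets : ∀ n → (Subset n → ℕ) → ℕ
sumSubsets zero    f = f []
sumSubsets (suc n) f = sumSubsets n (λ X → f (true ∷ X)) + sumSubsets n (λ X → f (false ∷ X))

sumSubsets-cong : ∀ n {f g : Subset n → ℕ} → (∀ X → f X ≡ g X) → sumSubsets n f ≡ sumSubsets n g
sumSubsets-cong zero    eq = eq []
sumSubsets-cong (suc n) eq =
  cong₂ _+_ (sumSubsets-cong n (λ X → eq (true ∷ X))) (sumSubsets-cong n (λ X → eq (false ∷ X)))

sumSubsets-+ : ∀ n (f g : Subset n → ℕ) →
               sumSubsets n (λ X → f X + g X) ≡ sumSubsets n f + sumSubsets n g
sumSubsets-+ zero    f g = refl
sumSubsets-+ (suc n) f g =
  trans (cong₂ _+_ (sumSubsets-+ n _ _) (sumSubsets-+ n _ _))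
        (+-interchange (sumSubsets n (λ X → f (true ∷ X))) _ _ _)

sumSubsets-0 : ∀ n → sumSubsets n (λ _ → 0) ≡ 0
sumSubsets-0 zero    = refl
sumSubsets-0 (suc n) = cong₂ _+_ (sumSubsets-0 n) (sumSubsets-0 n)

sumSubsets-atSuc : ∀ n k (h : ℕ → Subset n → ℕ) →
                   sumSubsets n (λ X → atSuc k (λ j → h j X)) ≡ atSuc k (λ j → sumSubsets n (h j))
sumSubsets-atSuc n zero    h = sumSubsets-0 n
sumSubsets-atSuc n (suc k) h = refl

sumSubsets-*ˡ : ∀ n m (f : Subset n → ℕ) → sumSubsets n (λ X → m * f X) ≡ m * sumSubsets n f
sumSubsets-*ˡ zero    m f = refl
sumSubsets-*ˡ (suc n) m f =
  trans (cong₂ _+_ (sumSubsets-*ˡ n m _) (sumSubsets-*ˡ n m _)) (sym (*-distribˡ-+ m _ _))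

sumSubsets-indicator : ∀ n (p : Subset n → Bool) →
                       sumSubsets n (λ X → indicator (p X)) ≡ count p (allSubsets n)
sumSubsets-indicator zero p with p []
... | true  = refl
... | false = refl
sumSubsets-indicator (suc n) p = sym (begin
  count p (map (true ∷_) (allSubsets n) ++ map (false ∷_) (allSubsets n))
    ≡⟨ count-++ p (map (true ∷_) (allSubsets n)) _ ⟩
  count p (map (true ∷_) (allSubsets n)) + count p (map (false ∷_) (allSubsets n))
    ≡⟨ cong₂ _+_ (count-map p (true ∷_) (allSubsets n)) (count-map p (false ∷_) (allSubsets n)) ⟩
  count (λ X → p (true ∷ X)) (allSubsets n) + count (λ X → p (false ∷ X)) (allSubsets n)
    ≡⟨ sym (cong₂ _+_ (sumSubsets-indicator n _) (sumSubsets-indicator n _)) ⟩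
  sumSubsets (suc n) (λ X → indicator (p X)) ∎)
  where open ≡-Reasoning

sumSubsets-ofSize : ∀ n k → sumSubsets n (λ X → indicator (∣ X ∣ ≡ᵇ k)) ≡ choose n k
sumSubsets-ofSize zero    zero    = refl
sumSubsets-ofSize zero    (suc k) = refl
sumSubsets-ofSize (suc n) zero    = cong₂ _+_ (sumSubsets-0 n) (sumSubsets-ofSize n zero)
sumSubsets-ofSize (suc n) (suc k) = cong₂ _+_ (sumSubsets-ofSize n k) (sumSubsets-ofSize n (suc k))

-- A colouring of the ground set encodes a disjoint triple (Z, A, W) =
-- (core, chosen, spare); sumColourings n k₁ k₂ k₃ ranges over those with
-- |Z| = k₁, |A| = k₂ and |W| = k₃.
data Colour : Set where
  outer core chosen spare : Colour

-- A coarse colouring keeps the core Z and merges A and W into a block Y.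
data Coarse : Set where
  outer core block : Coarse

support : ∀ {n} → Vec Colour n → Subset n
support []           = []
support (outer ∷ c)  = false ∷ support c
support (core ∷ c)   = true  ∷ support c
support (chosen ∷ c) = true  ∷ support c
support (spare ∷ c)  = false ∷ support c

sumColourings : ∀ n → ℕ → ℕ → ℕ → (Vec Colour n → ℕ) → ℕ
sumColourings zero    k₁ k₂ k₃ F = atZero k₁ (atZero k₂ (atZero k₃ (F [])))
sumColourings (suc n) k₁ k₂ k₃ F =
    (atSuc k₁ (λ k → sumColourings n k k₂ k₃ (λ c → F (core ∷ c)))
     + atSuc k₂ (λ k → sumColourings n k₁ k k₃ (λ c → F (chosen ∷ c))))
  + (sumColourings n k₁ k₂ k₃ (λ c → F (outer ∷ c))
     + atSuc k₃ (λ k → sumColourings n k₁ k₂ k (λ c → F (spare ∷ c))))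

sumOverSupport : ∀ {n} → Subset n → ℕ → ℕ → ℕ → (Vec Colour n → ℕ) → ℕ
sumOverSupport []          k₁ k₂ k₃ F = atZero k₁ (atZero k₂ (atZero k₃ (F [])))
sumOverSupport (true ∷ X)  k₁ k₂ k₃ F =
  atSuc k₁ (λ k → sumOverSupport X k k₂ k₃ (λ c → F (core ∷ c)))
  + atSuc k₂ (λ k → sumOverSupport X k₁ k k₃ (λ c → F (chosen ∷ c)))
sumOverSupport (false ∷ X) k₁ k₂ k₃ F =
  sumOverSupport X k₁ k₂ k₃ (λ c → F (outer ∷ c))
  + atSuc k₃ (λ k → sumOverSupport X k₁ k₂ k (λ c → F (spare ∷ c)))

sumColourings≡sumSubsets-sumOverSupport : ∀ n k₁ k₂ k₃ F →
  sumColourings n k₁ k₂ k₃ F ≡ sumSubsets n (λ X → sumOverSupport X k₁ k₂ k₃ F)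
sumColourings≡sumSubsets-sumOverSupport zero    k₁ k₂ k₃ F = refl
sumColourings≡sumSubsets-sumOverSupport (suc n) k₁ k₂ k₃ F =
  trans (cong₂ _+_ (cong₂ _+_ (atSuc-cong k₁ λ k → ih k k₂ k₃ _)
                              (atSuc-cong k₂ λ k → ih k₁ k k₃ _))
                   (cong₂ _+_ (ih k₁ k₂ k₃ _)
                              (atSuc-cong k₃ λ k → ih k₁ k₂ k _)))
        (sym (cong₂ _+_
          (trans (sumSubsets-+ n _ _) (cong₂ _+_ (sumSubsets-atSuc n k₁ _) (sumSubsets-atSuc n k₂ _)))
          (trans (sumSubsets-+ n _ _) (cong₂ _+_ refl (sumSubsets-atSuc n k₃ _)))))
  where
  ih : ∀ k₁ k₂ k₃ F → sumColourings n k₁ k₂ k₃ F ≡ sumSubsets n (λ X → sumOverSupport X k₁ k₂ k₃ F)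
  ih = sumColourings≡sumSubsets-sumOverSupport n

sumOverSupport-∘support : ∀ {n} (X : Subset n) k₁ k₂ k₃ (p : Subset n → ℕ) →
  sumOverSupport X k₁ k₂ k₃ (λ c → p (support c)) ≡ p X * sumOverSupport X k₁ k₂ k₃ (λ _ → 1)
sumOverSupport-∘support []          zero     zero     k₃ p = atZero-* k₃ (p [])
sumOverSupport-∘support []          zero     (suc _)  k₃ p = sym (*-zeroʳ (p []))
sumOverSupport-∘support []          (suc _)  k₂       k₃ p = sym (*-zeroʳ (p []))
sumOverSupport-∘support (true ∷ X)  k₁ k₂ k₃ p = begin
  atSuc k₁ (λ k → sumOverSupport X k k₂ k₃ (λ c → p (true ∷ support c)))
    + atSuc k₂ (λ k → sumOverSupport X k₁ k k₃ (λ c → p (true ∷ support c)))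
    ≡⟨ cong₂ _+_ (atSuc-cong k₁ λ k → sumOverSupport-∘support X k k₂ k₃ (λ S → p (true ∷ S)))
                 (atSuc-cong k₂ λ k → sumOverSupport-∘support X k₁ k k₃ (λ S → p (true ∷ S))) ⟩
  atSuc k₁ (λ k → m * sumOverSupport X k k₂ k₃ _) + atSuc k₂ (λ k → m * sumOverSupport X k₁ k k₃ _)
    ≡⟨ cong₂ _+_ (atSuc-*ˡ k₁ m _) (atSuc-*ˡ k₂ m _) ⟩
  m * atSuc k₁ (λ k → sumOverSupport X k k₂ k₃ _) + m * atSuc k₂ (λ k → sumOverSupport X k₁ k k₃ _)
    ≡⟨ *-distribˡ-+ m _ _ ⟨
  m * sumOverSupport (true ∷ X) k₁ k₂ k₃ (λ _ → 1) ∎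
  where
  open ≡-Reasoning
  m : ℕ
  m = p (true ∷ X)
sumOverSupport-∘support (false ∷ X) k₁ k₂ k₃ p = begin
  sumOverSupport X k₁ k₂ k₃ (λ c → p (false ∷ support c))
    + atSuc k₃ (λ k → sumOverSupport X k₁ k₂ k (λ c → p (false ∷ support c)))
    ≡⟨ cong₂ _+_ (sumOverSupport-∘support X k₁ k₂ k₃ (λ S → p (false ∷ S)))
                 (atSuc-cong k₃ λ k → sumOverSupport-∘support X k₁ k₂ k (λ S → p (false ∷ S))) ⟩
  m * sumOverSupport X k₁ k₂ k₃ _ + atSuc k₃ (λ k → m * sumOverSupport X k₁ k₂ k _)
    ≡⟨ cong₂ _+_ refl (atSuc-*ˡ k₃ m _) ⟩
  m * sumOverSupport X k₁ k₂ k₃ _ + m * atSuc k₃ (λ k → sumOverSupport X k₁ k₂ k _)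
    ≡⟨ *-distribˡ-+ m _ _ ⟨
  m * sumOverSupport (false ∷ X) k₁ k₂ k₃ (λ _ → 1) ∎
  where
  open ≡-Reasoning
  m : ℕ
  m = p (false ∷ X)

-- splits m k₁ k₂ is C(m, k₁) if m = k₁ + k₂, and 0 otherwise.
splits : ℕ → ℕ → ℕ → ℕ
splits zero    k₁ k₂ = atZero k₁ (atZero k₂ 1)
splits (suc m) k₁ k₂ = atSuc k₁ (λ k → splits m k k₂) + atSuc k₂ (λ k → splits m k₁ k)

splits-pos : ∀ k₁ k₂ → 0 < splits (k₁ + k₂) k₁ k₂
splits-pos zero     zero     = s≤s z≤n
splits-pos zero     (suc k₂) = splits-pos zero k₂
splits-pos (suc k₁) k₂       = ≤-trans (splits-pos k₁ k₂) (m≤m+n _ _)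

sumOverSupport-1 : ∀ {n} (X : Subset n) k₁ k₂ k₃ →
  sumOverSupport X k₁ k₂ k₃ (λ _ → 1) ≡ splits ∣ X ∣ k₁ k₂ * choose (∣ ∁ X ∣) k₃
sumOverSupport-1 []          zero    zero    zero    = refl
sumOverSupport-1 []          zero    zero    (suc _) = refl
sumOverSupport-1 []          zero    (suc _) k₃      = refl
sumOverSupport-1 []          (suc _) k₂      k₃      = refl
sumOverSupport-1 (true ∷ X)  k₁ k₂ k₃ = begin
  atSuc k₁ (λ k → sumOverSupport X k k₂ k₃ _) + atSuc k₂ (λ k → sumOverSupport X k₁ k k₃ _)
    ≡⟨ cong₂ _+_ (atSuc-cong k₁ λ k → sumOverSupport-1 X k k₂ k₃)
                 (atSuc-cong k₂ λ k → sumOverSupport-1 X k₁ k k₃) ⟩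
  atSuc k₁ (λ k → splits ∣ X ∣ k k₂ * m) + atSuc k₂ (λ k → splits ∣ X ∣ k₁ k * m)
    ≡⟨ cong₂ _+_ (atSuc-*ʳ k₁ m _) (atSuc-*ʳ k₂ m _) ⟩
  atSuc k₁ (λ k → splits ∣ X ∣ k k₂) * m + atSuc k₂ (λ k → splits ∣ X ∣ k₁ k) * m
    ≡⟨ *-distribʳ-+ m (atSuc k₁ _) _ ⟨
  splits ∣ true ∷ X ∣ k₁ k₂ * m ∎
  where
  open ≡-Reasoning
  m : ℕ
  m = choose (∣ ∁ X ∣) k₃
sumOverSupport-1 (false ∷ X) k₁ k₂ k₃ = begin
  sumOverSupport X k₁ k₂ k₃ _ + atSuc k₃ (λ k → sumOverSupport X k₁ k₂ k _)
    ≡⟨ cong₂ _+_ (sumOverSupport-1 X k₁ k₂ k₃) (atSuc-cong k₃ λ k → sumOverSupport-1 X k₁ k₂ k) ⟩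
  s * choose m k₃ + atSuc k₃ (λ k → s * choose m k)
    ≡⟨ cong₂ _+_ refl (atSuc-*ˡ k₃ s _) ⟩
  s * choose m k₃ + s * atSuc k₃ (choose m)
    ≡⟨ *-distribˡ-+ s _ _ ⟨
  s * (choose m k₃ + atSuc k₃ (choose m))
    ≡⟨ cong (s *_) (choose-suc m k₃) ⟩
  s * choose (suc m) k₃ ∎
  where
  open ≡-Reasoning
  s m : ℕ
  s = splits ∣ X ∣ k₁ k₂
  m = ∣ ∁ X ∣

coreOf : ∀ {n} → Vec Coarse n → Subset n
coreOf []          = []
coreOf (outer ∷ d) = false ∷ coreOf d
coreOf (core ∷ d)  = true  ∷ coreOf d
coreOf (block ∷ d) = false ∷ coreOf d

blockOf : ∀ {n} → Vec Coarse n → Subset n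
blockOf []          = []
blockOf (outer ∷ d) = false ∷ blockOf d
blockOf (core ∷ d)  = false ∷ blockOf d
blockOf (block ∷ d) = true  ∷ blockOf d

sumCoarse : ∀ n → ℕ → (Vec Coarse n → ℕ) → ℕ
sumCoarse zero    k G = atZero k (G [])
sumCoarse (suc n) k G =
  atSuc k (λ j → sumCoarse n j (λ d → G (core ∷ d))) + sumCoarse n k (λ d → G (outer ∷ d))
  + sumCoarse n k (λ d → G (block ∷ d))

sumRefinements : ∀ {n} → Vec Coarse n → ℕ → ℕ → (Vec Colour n → ℕ) → ℕ
sumRefinements []          k₂ k₃ F = atZero k₂ (atZero k₃ (F []))
sumRefinements (outer ∷ d) k₂ k₃ F = sumRefinements d k₂ k₃ (λ c → F (outer ∷ c))
sumRefinements (core ∷ d)  k₂ k₃ F = sumRefinements d k₂ k₃ (λ c → F (core ∷ c))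
sumRefinements (block ∷ d) k₂ k₃ F =
  atSuc k₂ (λ k → sumRefinements d k k₃ (λ c → F (chosen ∷ c)))
  + atSuc k₃ (λ k → sumRefinements d k₂ k (λ c → F (spare ∷ c)))

sumCoarse-0 : ∀ n k → sumCoarse n k (λ _ → 0) ≡ 0
sumCoarse-0 zero    zero    = refl
sumCoarse-0 zero    (suc k) = refl
sumCoarse-0 (suc n) k       =
  cong₂ _+_ (cong₂ _+_ (trans (atSuc-cong k λ j → sumCoarse-0 n j) (atSuc-0 k)) (sumCoarse-0 n k))
            (sumCoarse-0 n k)

sumCoarse-+ : ∀ n k (G H : Vec Coarse n → ℕ) →
              sumCoarse n k (λ d → G d + H d) ≡ sumCoarse n k G + sumCoarse n k H
sumCoarse-+ zero    zero    G H = refl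
sumCoarse-+ zero    (suc k) G H = refl
sumCoarse-+ (suc n) k       G H =
  trans (cong₂ _+_ (cong₂ _+_ (trans (atSuc-cong k λ j → sumCoarse-+ n j (at core G) (at core H))
                                     (atSuc-+ k (λ j → sumCoarse n j (at core G)) _))
                              (sumCoarse-+ n k (at outer G) (at outer H)))
                   (sumCoarse-+ n k (at block G) (at block H)))
        (+-rearrange (atSuc k (λ j → sumCoarse n j (at core G))) _ _ _ _ _)
  where
  at : Coarse → (Vec Coarse (suc n) → ℕ) → Vec Coarse n → ℕ
  at x G d = G (x ∷ d)
  +-rearrange : ∀ x₁ x₂ x₃ x₄ x₅ x₆ →
    (x₁ + x₂) + (x₃ + x₄) + (x₅ + x₆) ≡ x₁ + x₃ + x₅ + (x₂ + x₄ + x₆)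
  +-rearrange = solve-∀

sumCoarse-atSuc : ∀ n k₁ k (h : ℕ → Vec Coarse n → ℕ) →
  sumCoarse n k₁ (λ d → atSuc k (λ j → h j d)) ≡ atSuc k (λ j → sumCoarse n k₁ (h j))
sumCoarse-atSuc n k₁ zero    h = sumCoarse-0 n k₁
sumCoarse-atSuc n k₁ (suc k) h = refl

sumCoarse-*ˡ : ∀ n k m (G : Vec Coarse n → ℕ) → sumCoarse n k (λ d → m * G d) ≡ m * sumCoarse n k G
sumCoarse-*ˡ zero    zero    m G = refl
sumCoarse-*ˡ zero    (suc k) m G = sym (*-zeroʳ m)
sumCoarse-*ˡ (suc n) k       m G =
  trans (cong₂ _+_ (cong₂ _+_ (trans (atSuc-cong k λ j → sumCoarse-*ˡ n j m _) (atSuc-*ˡ k m _))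
                              (sumCoarse-*ˡ n k m _))
                   (sumCoarse-*ˡ n k m _))
        (sym (trans (*-distribˡ-+ m _ _) (cong₂ _+_ (*-distribˡ-+ m _ _) refl)))

sumCoarse-mono-≤ : ∀ n k {G H : Vec Coarse n → ℕ} →
  (∀ d → ∣ coreOf d ∣ ≡ k → G d ≤ H d) → sumCoarse n k G ≤ sumCoarse n k H
sumCoarse-mono-≤ zero    zero    le = le [] refl
sumCoarse-mono-≤ zero    (suc k) le = z≤n
sumCoarse-mono-≤ (suc n) k       le =
  +-mono-≤ (+-mono-≤ (viaCore k le) (sumCoarse-mono-≤ n k λ d → le (outer ∷ d)))
           (sumCoarse-mono-≤ n k λ d → le (block ∷ d))
  where
  viaCore : ∀ k {G H : Vec Coarse (suc n) → ℕ} → (∀ d → ∣ coreOf d ∣ ≡ k → G d ≤ H d) →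
            atSuc k (λ j → sumCoarse n j (λ d → G (core ∷ d)))
              ≤ atSuc k (λ j → sumCoarse n j (λ d → H (core ∷ d)))
  viaCore zero    le = z≤n
  viaCore (suc j) le = sumCoarse-mono-≤ n j λ d e → le (core ∷ d) (cong suc e)

sumColourings≡sumCoarse-sumRefinements : ∀ n k₁ k₂ k₃ F →
  sumColourings n k₁ k₂ k₃ F ≡ sumCoarse n k₁ (λ d → sumRefinements d k₂ k₃ F)
sumColourings≡sumCoarse-sumRefinements zero    k₁ k₂ k₃ F = refl
sumColourings≡sumCoarse-sumRefinements (suc n) k₁ k₂ k₃ F =
  trans (+-interchange (atSuc k₁ _) _ _ _)
        (cong₂ _+_ (cong₂ _+_ (atSuc-cong k₁ λ k → ih k k₂ k₃ _) (ih k₁ k₂ k₃ _))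
                   (trans (cong₂ _+_ (atSuc-cong k₂ λ k → ih k₁ k k₃ _) (atSuc-cong k₃ λ k → ih k₁ k₂ k _))
                          (sym (trans (sumCoarse-+ n k₁ _ _)
                                      (cong₂ _+_ (sumCoarse-atSuc n k₁ k₂ _) (sumCoarse-atSuc n k₁ k₃ _))))))
  where
  ih : ∀ k₁ k₂ k₃ F → sumColourings n k₁ k₂ k₃ F ≡ sumCoarse n k₁ (λ d → sumRefinements d k₂ k₃ F)
  ih = sumColourings≡sumCoarse-sumRefinements n

sumRefinements-mono-≤ : ∀ {n} (d : Vec Coarse n) k₂ k₃ {F G : Vec Colour n → ℕ} →
  (∀ c → F c ≤ G c) → sumRefinements d k₂ k₃ F ≤ sumRefinements d k₂ k₃ G
sumRefinements-mono-≤ []          zero    zero    le = le []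
sumRefinements-mono-≤ []          zero    (suc _) le = z≤n
sumRefinements-mono-≤ []          (suc _) _       le = z≤n
sumRefinements-mono-≤ (outer ∷ d) k₂ k₃ le = sumRefinements-mono-≤ d k₂ k₃ λ c → le (outer ∷ c)
sumRefinements-mono-≤ (core ∷ d)  k₂ k₃ le = sumRefinements-mono-≤ d k₂ k₃ λ c → le (core ∷ c)
sumRefinements-mono-≤ (block ∷ d) k₂ k₃ le =
  +-mono-≤ (atSuc-mono-≤ k₂ λ k → sumRefinements-mono-≤ d k k₃ λ c → le (chosen ∷ c))
           (atSuc-mono-≤ k₃ λ k → sumRefinements-mono-≤ d k₂ k λ c → le (spare ∷ c))

sumRefinements-1≤choose : ∀ {n} (d : Vec Coarse n) k₂ k₃ →
  sumRefinements d k₂ k₃ (λ _ → 1) ≤ choose (k₂ + k₃) k₂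
sumRefinements-1≤choose []          zero     zero     = ≤-refl
sumRefinements-1≤choose []          zero     (suc _)  = z≤n
sumRefinements-1≤choose []          (suc _)  _        = z≤n
sumRefinements-1≤choose (outer ∷ d) k₂       k₃       = sumRefinements-1≤choose d k₂ k₃
sumRefinements-1≤choose (core ∷ d)  k₂       k₃       = sumRefinements-1≤choose d k₂ k₃
sumRefinements-1≤choose (block ∷ d) zero     zero     = z≤n
sumRefinements-1≤choose (block ∷ d) zero     (suc j)  = sumRefinements-1≤choose d zero j
sumRefinements-1≤choose (block ∷ d) (suc i)  zero     = +-mono-≤ (sumRefinements-1≤choose d i zero) z≤n
sumRefinements-1≤choose (block ∷ d) (suc i)  (suc j)  =
  +-mono-≤ (sumRefinements-1≤choose d i (suc j))
           (subst (λ t → sumRefinements d (suc i) j (λ _ → 1) ≤ choose t (suc i)) (sym (+-suc i j))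
                  (sumRefinements-1≤choose d (suc i) j))

m+n>0⇒m>0⊎n>0 : ∀ m {n} → 0 < m + n → 0 < m ⊎ 0 < n
m+n>0⇒m>0⊎n>0 zero    pos = inj₂ pos
m+n>0⇒m>0⊎n>0 (suc m) _   = inj₁ (s≤s z≤n)

sumRefinements-pos⇒∣blockOf∣ : ∀ {n} (d : Vec Coarse n) k₂ k₃ {F : Vec Colour n → ℕ} →
  0 < sumRefinements d k₂ k₃ F → ∣ blockOf d ∣ ≡ k₂ + k₃
sumRefinements-pos⇒∣blockOf∣ []          zero    zero    pos = refl
sumRefinements-pos⇒∣blockOf∣ (outer ∷ d) k₂      k₃      pos = sumRefinements-pos⇒∣blockOf∣ d k₂ k₃ pos
sumRefinements-pos⇒∣blockOf∣ (core ∷ d)  k₂      k₃      pos = sumRefinements-pos⇒∣blockOf∣ d k₂ k₃ pos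
sumRefinements-pos⇒∣blockOf∣ (block ∷ d) k₂      k₃      pos with m+n>0⇒m>0⊎n>0 (atSuc k₂ _) pos
sumRefinements-pos⇒∣blockOf∣ (block ∷ d) (suc i) k₃      _ | inj₁ pos =
  cong suc (sumRefinements-pos⇒∣blockOf∣ d i k₃ pos)
sumRefinements-pos⇒∣blockOf∣ (block ∷ d) k₂      (suc j) _ | inj₂ pos =
  trans (cong suc (sumRefinements-pos⇒∣blockOf∣ d k₂ j pos)) (sym (+-suc k₂ j))

refine : ∀ {n} → Vec Coarse n → Subset n → Vec Colour n
refine []          []          = []
refine (outer ∷ d) (_ ∷ X)     = outer ∷ refine d X
refine (core ∷ d)  (_ ∷ X)     = core ∷ refine d X
refine (block ∷ d) (true ∷ X)  = chosen ∷ refine d X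
refine (block ∷ d) (false ∷ X) = spare ∷ refine d X

sumRefinements≡0⇒refinement≡0 : ∀ {n} (d : Vec Coarse n) X {k₂ k₃} (F : Vec Colour n → ℕ) →
  X ⊆ blockOf d → ∣ X ∣ ≡ k₂ → ∣ blockOf d ∣ ≡ k₂ + k₃ →
  sumRefinements d k₂ k₃ F ≡ 0 → F (refine d X) ≡ 0
sumRefinements≡0⇒refinement≡0 []          []          F _ refl refl vanish = vanish
sumRefinements≡0⇒refinement≡0 (outer ∷ d) (true ∷ X)  F X⊆ _ _ _ = contradiction (X⊆ here) λ ()
sumRefinements≡0⇒refinement≡0 (core ∷ d)  (true ∷ X)  F X⊆ _ _ _ = contradiction (X⊆ here) λ ()
sumRefinements≡0⇒refinement≡0 (outer ∷ d) (false ∷ X) F X⊆ ∣X∣ ∣d∣ vanish =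
  sumRefinements≡0⇒refinement≡0 d X (λ c → F (outer ∷ c)) (drop-∷-⊆ X⊆) ∣X∣ ∣d∣ vanish
sumRefinements≡0⇒refinement≡0 (core ∷ d)  (false ∷ X) F X⊆ ∣X∣ ∣d∣ vanish =
  sumRefinements≡0⇒refinement≡0 d X (λ c → F (core ∷ c)) (drop-∷-⊆ X⊆) ∣X∣ ∣d∣ vanish
sumRefinements≡0⇒refinement≡0 (block ∷ d) (true ∷ X)  {suc k₂} F X⊆ refl ∣d∣ vanish =
  sumRefinements≡0⇒refinement≡0 d X (λ c → F (chosen ∷ c)) (drop-∷-⊆ X⊆) refl (suc-injective ∣d∣)
    (m+n≡0⇒m≡0 _ vanish)
sumRefinements≡0⇒refinement≡0 (block ∷ d) (false ∷ X) {k₃ = zero} F X⊆ refl ∣d∣ _ =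
  contradiction (p⊆q⇒∣p∣≤∣q∣ (drop-∷-⊆ X⊆))
    (<⇒≱ (≤-reflexive (trans ∣d∣ (+-identityʳ ∣ X ∣))))
sumRefinements≡0⇒refinement≡0 (block ∷ d) (false ∷ X) {k₂} {suc k₃} F X⊆ ∣X∣ ∣d∣ vanish =
  sumRefinements≡0⇒refinement≡0 d X (λ c → F (spare ∷ c)) (drop-∷-⊆ X⊆) ∣X∣
    (suc-injective (trans ∣d∣ (+-suc k₂ k₃))) (m+n≡0⇒n≡0 (atSuc k₂ _) vanish)

support-refine : ∀ {n} (d : Vec Coarse n) X → X ⊆ blockOf d → support (refine d X) ≡ coreOf d ∪ X
support-refine []          []          _  = refl
support-refine (outer ∷ d) (true ∷ X)  X⊆ = contradiction (X⊆ here) λ ()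
support-refine (core ∷ d)  (true ∷ X)  X⊆ = contradiction (X⊆ here) λ ()
support-refine (outer ∷ d) (false ∷ X) X⊆ = cong (false ∷_) (support-refine d X (drop-∷-⊆ X⊆))
support-refine (core ∷ d)  (false ∷ X) X⊆ = cong (true ∷_)  (support-refine d X (drop-∷-⊆ X⊆))
support-refine (block ∷ d) (true ∷ X)  X⊆ = cong (true ∷_)  (support-refine d X (drop-∷-⊆ X⊆))
support-refine (block ∷ d) (false ∷ X) X⊆ = cong (false ∷_) (support-refine d X (drop-∷-⊆ X⊆))

coreOf-disjoint-blockOf : ∀ {n} (d : Vec Coarse n) → Disjoint (coreOf d) (blockOf d)
coreOf-disjoint-blockOf (core ∷ d)  fzero here ()
coreOf-disjoint-blockOf (block ∷ d) fzero () here
coreOf-disjoint-blockOf (outer ∷ d) (fsuc e) (there x) (there y) = coreOf-disjoint-blockOf d e x y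
coreOf-disjoint-blockOf (core ∷ d)  (fsuc e) (there x) (there y) = coreOf-disjoint-blockOf d e x y
coreOf-disjoint-blockOf (block ∷ d) (fsuc e) (there x) (there y) = coreOf-disjoint-blockOf d e x y

Disjoint-tail : ∀ {n} {s t} {p q : Subset n} → Disjoint (s ∷ p) (t ∷ q) → Disjoint p q
Disjoint-tail disj e x y = disj (fsuc e) (there x) (there y)

Disjoint⇒∣p∪q∣≡∣p∣+∣q∣ : ∀ {n} (p q : Subset n) → Disjoint p q → ∣ p ∪ q ∣ ≡ ∣ p ∣ + ∣ q ∣
Disjoint⇒∣p∪q∣≡∣p∣+∣q∣ [] []          _    = refl
Disjoint⇒∣p∪q∣≡∣p∣+∣q∣ (true ∷ p)  (true ∷ q)  disj = contradiction here (disj fzero here)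
Disjoint⇒∣p∪q∣≡∣p∣+∣q∣ (true ∷ p)  (false ∷ q) disj =
  cong suc (Disjoint⇒∣p∪q∣≡∣p∣+∣q∣ p q (Disjoint-tail disj))
Disjoint⇒∣p∪q∣≡∣p∣+∣q∣ (false ∷ p) (true ∷ q)  disj =
  trans (cong suc (Disjoint⇒∣p∪q∣≡∣p∣+∣q∣ p q (Disjoint-tail disj))) (sym (+-suc ∣ p ∣ ∣ q ∣))
Disjoint⇒∣p∪q∣≡∣p∣+∣q∣ (false ∷ p) (false ∷ q) disj =
  Disjoint⇒∣p∪q∣≡∣p∣+∣q∣ p q (Disjoint-tail disj)

⊆-extend : ∀ {n} {X Y : Subset n} k → X ⊆ Y → ∣ X ∣ ≤ k → k ≤ ∣ Y ∣ →
           ∃[ A ] (X ⊆ A × A ⊆ Y × ∣ A ∣ ≡ k)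
⊆-extend {X = []}         {[]}         zero    _  _  _   = [] , (λ ()) , (λ ()) , refl
⊆-extend {X = true ∷ X}   {false ∷ Y}  k       X⊆ _  _   = contradiction (X⊆ here) λ ()
⊆-extend {X = true ∷ X}   {true ∷ Y}   (suc k) X⊆ (s≤s ∣X∣≤) (s≤s ≤∣Y∣)
  with A , X⊆A , A⊆ , ∣A∣ ← ⊆-extend k (drop-∷-⊆ X⊆) ∣X∣≤ ≤∣Y∣
  = true ∷ A , in⊆in X⊆A , in⊆in A⊆ , cong suc ∣A∣
⊆-extend {X = false ∷ X}  {false ∷ Y}  k       X⊆ ∣X∣≤ ≤∣Y∣
  with A , X⊆A , A⊆ , ∣A∣ ← ⊆-extend k (drop-∷-⊆ X⊆) ∣X∣≤ ≤∣Y∣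
  = false ∷ A , out⊆ X⊆A , out⊆ A⊆ , ∣A∣
⊆-extend {X = false ∷ X}  {true ∷ Y}   zero    X⊆ ∣X∣≤ _
  with A , X⊆A , A⊆ , ∣A∣ ← ⊆-extend zero (drop-∷-⊆ X⊆) ∣X∣≤ z≤n
  = false ∷ A , out⊆ X⊆A , out⊆ A⊆ , ∣A∣
⊆-extend {X = false ∷ X}  {true ∷ Y}   (suc k) X⊆ ∣X∣≤ (s≤s k≤∣Y∣) with ∣ X ∣ ≤? k
... | yes ∣X∣≤k
  with A , X⊆A , A⊆ , ∣A∣ ← ⊆-extend k (drop-∷-⊆ X⊆) ∣X∣≤k k≤∣Y∣
  = true ∷ A , out⊆ X⊆A , in⊆in A⊆ , cong suc ∣A∣
... | no ∣X∣≰k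
  with A , X⊆A , A⊆ , ∣A∣ ← ⊆-extend (suc k) (drop-∷-⊆ X⊆) ∣X∣≤
                              (≤-trans (≰⇒> ∣X∣≰k) (p⊆q⇒∣p∣≤∣q∣ (drop-∷-⊆ X⊆)))
  = false ∷ A , out⊆ X⊆A , out⊆ A⊆ , ∣A∣

basis-of-independent-size : ∀ {n} (M : Matroid n) {S B : Subset n} →
  indep M S ≡ true → IsBasisOf M S B → ∣ B ∣ ≡ ∣ S ∣
basis-of-independent-size M {S} {B} S-indep (B⊆S , B-indep , B-maximal) =
  ≤-antisym (p⊆q⇒∣p∣≤∣q∣ B⊆S) (≮⇒≥ ∣B∣≮∣S∣)
  where
  ∣B∣≮∣S∣ : ¬ (∣ B ∣ < ∣ S ∣)
  ∣B∣≮∣S∣ ∣B∣<∣S∣ with e , e∈S , e∉B , B+e-indep ← indep-aug M B-indep S-indep ∣B∣<∣S∣ =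
    contradiction (trans (sym B+e-indep) (B-maximal e e∈S e∉B)) λ ()

-- With the rank of M at most |Z| + a, contracting the independent set Z
-- leaves exactly the sets of size ≤ a independent inside Y.
hasUniformMinor : ∀ {n} (M : Matroid n) {a b} (Z Y : Subset n) → Disjoint Z Y → ∣ Y ∣ ≡ b → a ≤ b →
  (∀ X → indep M X ≡ true → ∣ X ∣ ≤ ∣ Z ∣ + a) →
  (∀ X → X ⊆ Y → ∣ X ∣ ≡ a → indep M (Z ∪ X) ≡ true) →
  HasUniformMinor M a b
hasUniformMinor {n} M {a} Z Y Z∩Y ∣Y∣ a≤b rank≤ Z∪X-indep =
  Z , Y , Z∩Y , ∣Y∣ , λ X X⊆Y → forth X X⊆Y , back X X⊆Y
  where
  a≤∣Y∣ : a ≤ ∣ Y ∣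
  a≤∣Y∣ = subst (a ≤_) (sym ∣Y∣) a≤b

  Z-indep : indep M Z ≡ true
  Z-indep with A , _ , A⊆Y , ∣A∣ ← ⊆-extend a (⊆-min Y) (≤-trans (≤-reflexive (∣⊥∣≡0 n)) z≤n) a≤∣Y∣ =
    indep-⊆ M (p⊆p∪q A) (Z∪X-indep A A⊆Y ∣A∣)

  back : ∀ X → X ⊆ Y → ∣ X ∣ ≤ a → ContractIndep M Z X
  back X X⊆Y ∣X∣≤a with A , X⊆A , A⊆Y , ∣A∣ ← ⊆-extend a X⊆Y ∣X∣≤a a≤∣Y∣ =
    Z , (⊆-refl , Z-indep , λ e e∈Z e∉Z → contradiction e∈Z e∉Z) ,
    indep-⊆ M X∪Z⊆Z∪A (Z∪X-indep A A⊆Y ∣A∣)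
    where
    X∪Z⊆Z∪A : X ∪ Z ⊆ Z ∪ A
    X∪Z⊆Z∪A {e} e∈X∪Z with x∈p∪q⁻ X Z e∈X∪Z
    ... | inj₁ e∈X = q⊆p∪q Z A (X⊆A e∈X)
    ... | inj₂ e∈Z = p⊆p∪q A e∈Z

  forth : ∀ X → X ⊆ Y → ContractIndep M Z X → ∣ X ∣ ≤ a
  forth X X⊆Y (B , B-basis@(B⊆Z , _ , _) , X∪B-indep) = +-cancelʳ-≤ ∣ Z ∣ ∣ X ∣ a (begin
    ∣ X ∣ + ∣ Z ∣ ≡⟨ cong (∣ X ∣ +_) (basis-of-independent-size M Z-indep B-basis) ⟨
    ∣ X ∣ + ∣ B ∣ ≡⟨ Disjoint⇒∣p∪q∣≡∣p∣+∣q∣ X B (λ e e∈X e∈B → Z∩Y e (B⊆Z e∈B) (X⊆Y e∈X)) ⟨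
    ∣ X ∪ B ∣     ≤⟨ rank≤ (X ∪ B) X∪B-indep ⟩
    ∣ Z ∣ + a     ≡⟨ +-comm ∣ Z ∣ a ⟩
    a + ∣ Z ∣     ∎)
    where open ≤-Reasoning

rSetIndicator : ∀ {n} → ℕ → (Subset n → Bool) → Subset n → ℕ
rSetIndicator r q X = indicator ((∣ X ∣ ≡ᵇ r) ∧ q X)

rSetIndicator≡0⇒q≡false : ∀ {n} {r} {q : Subset n → Bool} {X} →
  ∣ X ∣ ≡ r → rSetIndicator r q X ≡ 0 → q X ≡ false
rSetIndicator≡0⇒q≡false {r = r} {q} {X} ∣X∣≡r vanish
  with ∣ X ∣ ≡ᵇ r | ≡⇒≡ᵇ ∣ X ∣ r ∣X∣≡r | q X
... | true | _ | false = refl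

count-rSets : ∀ n r → count (λ X → (∣ X ∣ ≡ᵇ r) ∧ true) (allSubsets n) ≡ n C r
count-rSets n r = begin
  count (λ X → (∣ X ∣ ≡ᵇ r) ∧ true) (allSubsets n)
    ≡⟨ sumSubsets-indicator n _ ⟨
  sumSubsets n (λ X → indicator ((∣ X ∣ ≡ᵇ r) ∧ true))
    ≡⟨ sumSubsets-cong n (λ X → cong indicator (∧-identityʳ (∣ X ∣ ≡ᵇ r))) ⟩
  sumSubsets n (λ X → indicator (∣ X ∣ ≡ᵇ r))
    ≡⟨ sumSubsets-ofSize n r ⟩
  choose n r
    ≡⟨ choose≡C n r ⟩
  n C r ∎
  where open ≡-Reasoning

sumColourings-rSetIndicator : ∀ n r k₁ k₂ k₃ (q : Subset n → Bool) →
  sumColourings n k₁ k₂ k₃ (λ c → rSetIndicator r q (support c))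
    ≡ splits r k₁ k₂ * choose (n ∸ r) k₃ * count (λ X → (∣ X ∣ ≡ᵇ r) ∧ q X) (allSubsets n)
sumColourings-rSetIndicator n r k₁ k₂ k₃ q = begin
  sumColourings n k₁ k₂ k₃ (λ c → χ (support c))
    ≡⟨ sumColourings≡sumSubsets-sumOverSupport n k₁ k₂ k₃ _ ⟩
  sumSubsets n (λ X → sumOverSupport X k₁ k₂ k₃ (λ c → χ (support c)))
    ≡⟨ sumSubsets-cong n (λ X → trans (sumOverSupport-∘support X k₁ k₂ k₃ χ)
                                      (cong (χ X *_) (sumOverSupport-1 X k₁ k₂ k₃))) ⟩
  sumSubsets n (λ X → χ X * (splits ∣ X ∣ k₁ k₂ * choose (∣ ∁ X ∣) k₃))
    ≡⟨ sumSubsets-cong n onRSets ⟩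
  sumSubsets n (λ X → K * χ X)
    ≡⟨ sumSubsets-*ˡ n K χ ⟩
  K * sumSubsets n χ
    ≡⟨ cong (K *_) (sumSubsets-indicator n _) ⟩
  K * count (λ X → (∣ X ∣ ≡ᵇ r) ∧ q X) (allSubsets n) ∎
  where
  open ≡-Reasoning
  χ : Subset n → ℕ
  χ = rSetIndicator r q
  K : ℕ
  K = splits r k₁ k₂ * choose (n ∸ r) k₃
  onRSets : ∀ X → χ X * (splits ∣ X ∣ k₁ k₂ * choose (∣ ∁ X ∣) k₃) ≡ K * χ X
  onRSets X with ∣ X ∣ ≡ᵇ r in ∣X∣≡ᵇr
  ... | false = sym (*-zeroʳ K)
  ... | true  = trans (cong (λ (s , m) → indicator (q X) * (splits s k₁ k₂ * choose m k₃))
                            (cong₂ _,_ ∣X∣≡r (trans (∣∁p∣≡n∸∣p∣ X) (cong (n ∸_) ∣X∣≡r))))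
                      (*-comm (indicator (q X)) K)
    where
    ∣X∣≡r : ∣ X ∣ ≡ r
    ∣X∣≡r = ≡ᵇ⇒≡ ∣ X ∣ r (subst T (sym ∣X∣≡ᵇr) _)

dependent : ∀ {n} → Matroid n → Subset n → Bool
dependent M X = not (indep M X)

module RefinementBound {n} (M : Matroid n) {a b r : ℕ} (a≤b : a ≤ b) (a≤r : a ≤ r)
         (rank≤ : ∀ X → indep M X ≡ true → ∣ X ∣ ≤ r) (noMinor : ¬ HasUniformMinor M a b) where

  rSetsRefining : Vec Coarse n → (Subset n → Bool) → ℕ
  rSetsRefining d q = sumRefinements d a (b ∸ a) (λ c → rSetIndicator r q (support c))

  rSetsRefining≤choose : ∀ d → rSetsRefining d (λ _ → true) ≤ choose b a
  rSetsRefining≤choose d = begin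
    rSetsRefining d (λ _ → true)          ≤⟨ sumRefinements-mono-≤ d a (b ∸ a) (λ _ → indicator≤1 _) ⟩
    sumRefinements d a (b ∸ a) (λ _ → 1)  ≤⟨ sumRefinements-1≤choose d a (b ∸ a) ⟩
    choose (a + (b ∸ a)) a                ≡⟨ cong (λ t → choose t a) (m+[n∸m]≡n a≤b) ⟩
    choose b a                            ∎
    where open ≤-Reasoning

  -- If no r-set refining d were dependent, contracting the core of d and
  -- restricting to its block would give a U_{a,b} minor.
  rSetsRefining-dependent-pos : ∀ d → ∣ coreOf d ∣ ≡ r ∸ a →
    0 < rSetsRefining d (λ _ → true) → 0 < rSetsRefining d (dependent M)
  rSetsRefining-dependent-pos d ∣Z∣ pos with rSetsRefining d (dependent M) ≟ 0
  ... | no  dep≢0 = n≢0⇒n>0 dep≢0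
  ... | yes dep≡0 = contradiction
    (hasUniformMinor M (coreOf d) (blockOf d) (coreOf-disjoint-blockOf d)
       (trans ∣Y∣ (m+[n∸m]≡n a≤b)) a≤b rank≤′ Z∪X-indep)
    noMinor
    where
    ∣Y∣ : ∣ blockOf d ∣ ≡ a + (b ∸ a)
    ∣Y∣ = sumRefinements-pos⇒∣blockOf∣ d a (b ∸ a) pos

    r≡∣Z∣+a : r ≡ ∣ coreOf d ∣ + a
    r≡∣Z∣+a = trans (sym (m∸n+n≡m a≤r)) (cong (_+ a) (sym ∣Z∣))

    rank≤′ : ∀ X → indep M X ≡ true → ∣ X ∣ ≤ ∣ coreOf d ∣ + a
    rank≤′ X X-indep = subst (∣ X ∣ ≤_) r≡∣Z∣+a (rank≤ X X-indep)

    Z∪X-indep : ∀ X → X ⊆ blockOf d → ∣ X ∣ ≡ a → indep M (coreOf d ∪ X) ≡ true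
    Z∪X-indep X X⊆Y ∣X∣ =
      not-injective (rSetIndicator≡0⇒q≡false {q = dependent M} ∣Z∪X∣ Z∪X-vanishes)
      where
      ∣Z∪X∣ : ∣ coreOf d ∪ X ∣ ≡ r
      ∣Z∪X∣ = trans (Disjoint⇒∣p∪q∣≡∣p∣+∣q∣ (coreOf d) X
                      λ e e∈Z e∈X → coreOf-disjoint-blockOf d e e∈Z (X⊆Y e∈X))
                    (trans (cong (∣ coreOf d ∣ +_) ∣X∣) (sym r≡∣Z∣+a))
      Z∪X-vanishes : rSetIndicator r (dependent M) (coreOf d ∪ X) ≡ 0
      Z∪X-vanishes = subst (λ S → rSetIndicator r (dependent M) S ≡ 0) (support-refine d X X⊆Y)
        (sumRefinements≡0⇒refinement≡0 d X _ X⊆Y ∣X∣ ∣Y∣ dep≡0)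

  rSetsRefining-bound : ∀ d → ∣ coreOf d ∣ ≡ r ∸ a →
    rSetsRefining d (λ _ → true) ≤ choose b a * rSetsRefining d (dependent M)
  rSetsRefining-bound d ∣Z∣ with rSetsRefining d (λ _ → true) ≟ 0
  ... | yes all≡0 = subst (_≤ choose b a * rSetsRefining d (dependent M)) (sym all≡0) z≤n
  ... | no  all≢0 = ≤-trans (rSetsRefining≤choose d)
      (m≤m*n (choose b a) _ {{>-nonZero (rSetsRefining-dependent-pos d ∣Z∣ (n≢0⇒n>0 all≢0))}})

lemma4p7 : (a b r n : ℕ) → a ≤ b → r ≤ n → a ≤ r → b ∸ a ≤ n ∸ r →
    (M : Matroid n) → HasRank M r → ¬ HasUniformMinor M a b →
    n C r ≤ numDependent M r * (b C a)
lemma4p7 a b r n a≤b _ a≤r b∸a≤n∸r M (_ , rank≤) noMinor =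
  *-cancelʳ-≤ (n C r) _ K {{>-nonZero K-pos}} (begin
    (n C r) * K                           ≡⟨ *-comm (n C r) K ⟩
    K * (n C r)                           ≡⟨ cong (K *_) (count-rSets n r) ⟨
    K * count allRSets (allSubsets n)     ≡⟨ sumColourings-rSetIndicator n r k₁ a k₃ (λ _ → true) ⟨
    colouringsWith (λ _ → true)           ≡⟨ sumColourings≡sumCoarse-sumRefinements n k₁ a k₃ _ ⟩
    sumCoarse n k₁ (λ d → rSetsRefining d (λ _ → true))
      ≤⟨ sumCoarse-mono-≤ n k₁ rSetsRefining-bound ⟩
    sumCoarse n k₁ (λ d → choose b a * rSetsRefining d (dependent M))
      ≡⟨ sumCoarse-*ˡ n k₁ (choose b a) _ ⟩
    choose b a * sumCoarse n k₁ (λ d → rSetsRefining d (dependent M))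
      ≡⟨ cong (choose b a *_) (sumColourings≡sumCoarse-sumRefinements n k₁ a k₃ _) ⟨
    choose b a * colouringsWith (dependent M)
      ≡⟨ cong (choose b a *_) (sumColourings-rSetIndicator n r k₁ a k₃ (dependent M)) ⟩
    choose b a * (K * numDependent M r)   ≡⟨ cong (_* (K * numDependent M r)) (choose≡C b a) ⟩
    (b C a) * (K * numDependent M r)      ≡⟨ *-rearrange (b C a) K (numDependent M r) ⟩
    numDependent M r * (b C a) * K        ∎)
  where
  open ≤-Reasoning
  open RefinementBound M a≤b a≤r rank≤ noMinor

  k₁ k₃ K : ℕ
  k₁ = r ∸ a
  k₃ = b ∸ a
  K  = splits r k₁ a * choose (n ∸ r) k₃

  K-pos : 0 < K
  K-pos = *-mono-≤ (subst (λ t → 0 < splits t k₁ a) (m∸n+n≡m a≤r) (splits-pos k₁ a))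
                   (choose-pos b∸a≤n∸r)

  allRSets : Subset n → Bool
  allRSets X = (∣ X ∣ ≡ᵇ r) ∧ true

  colouringsWith : (Subset n → Bool) → ℕ
  colouringsWith q = sumColourings n k₁ a k₃ (λ c → rSetIndicator r q (support c))

  *-rearrange : ∀ x y z → x * (y * z) ≡ z * x * y
  *-rearrange = solve-∀
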